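{- Let $K_{2,n}$ be a subgraph of $\mathcal{G}_\infty$ with partite sets $X$ and $Y$ (every vertex of $X$ adjacent to every vertex of $Y$), where $|X|=2$ and $|Y|=n>3$. Then either $X\subseteq 6\mathbb{N}_0$ and $Y\cap 6\mathbb{N}_0=\emptyset$, or $X\cap 6\mathbb{N}_0=\emptyset$ and $|Y\setminus 6\mathbb{N}_0|\le 1$.
   Context: Let $\mathcal{P}$ be the set of odd primes and $\mathbb{N}_0=\{0,1,2,\dots\}$, so $6\mathbb{N}_0=\{0,6,12,\dots\}$. $\mathcal{G}_\infty$ is the simple undirected graph whose vertex set is the set of non-negative even integers, in which distinct $a,b$ are adjacent iff $\frac{a+b}{2}\in\mathcal{P}$ and $\frac{|a-b|}{2}\in\mathcal{P}$. -}

module Defs where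

open import Data.Nat using (ℕ; _+_; _/_; ∣_-_∣)
open import Data.Nat.Divisibility using (_∣_)
open import Data.Nat.Primality using (Prime)
open import Data.Product using (_×_)
open import Relation.Binary.PropositionalEquality using (_≡_)
open import Relation.Nullary using (¬_)

OddPrime : ℕ → Set
OddPrime p = Prime p × ¬ (2 ∣ p)

-- vertices of 𝒢∞ : non-negative even integers
Even : ℕ → Set
Even n = 2 ∣ n

-- adjacency in 𝒢∞ (for even a, b): distinct, (a+b)/2 ∈ 𝒫 and |a-b|/2 ∈ 𝒫
Adj : ℕ → ℕ → Set
Adj a b = (¬ a ≡ b) × OddPrime ((a + b) / 2) × OddPrime (∣ a - b ∣ / 2)

-- Write a = 2u, b = 2v, so that a ~ b means that u + v and ∣u − v∣ are odd primes.
-- If 3 divides u and v, the prime u + v is 3, i.e. a + b = 6. If 3 divides neither,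
-- then 3 divides u + v or ∣u − v∣ (according as the residues differ or agree); the
-- first forces {u, v} = {1, 2} with ∣u − v∣ = 1 not prime, so ∣u − v∣ = 3, i.e.
-- ∣a − b∣ = 6. Hence a vertex x with 6 ∣ x has at most one neighbour divisible by 6
-- (namely 6 − x), and a vertex x with 6 ∤ x has at most two neighbours not divisible
-- by 6 (namely x ± 6); two such neighbours determine x as their midpoint.
module Submission where

open import Defs
open import Data.Nat using (ℕ; _≤_; _<_)
open import Data.Nat.Divisibility using (_∣_; _∣?_)
open import Data.List using (List; length; filter)
open import Data.List.Relation.Unary.All using (All)
open import Data.List.Relation.Unary.Unique.Propositional using (Unique)
open import Data.List.Membership.Propositional using (_∈_; _∉_)
open import Data.Product using (_×_)
open import Data.Sum using (_⊎_)
open import Relation.Binary.PropositionalEquality using (_≡_)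
open import Relation.Nullary using (¬_)
open import Relation.Nullary.Decidable using (¬?)

open import Function using (_∘_)
open import Data.Nat using (zero; suc; _+_; _*_; ∣_-_∣; z≤n; s≤s)
open import Data.Nat.Properties
open import Data.Nat.DivMod using (_/_; _%_; m≡m%n+[m/n]*n; m%n<n; m*n/n≡m)
open import Data.Nat.Divisibility using (divides; ∣m∣n⇒∣m+n; *-cancelʳ-∣; *-monoˡ-∣)
open import Data.Nat.Primality using (Prime; prime⇒irreducible; ¬prime[1])
open import Data.Nat.Tactic.RingSolver using (solve-∀)
open import Data.List using ([]; _∷_)
open import Data.List.Relation.Unary.All as All using (_∷_)
open import Data.List.Relation.Unary.All.Properties using (all-filter; filter⁺)
open import Data.List.Relation.Unary.AllPairs using (_∷_)
open import Data.List.Relation.Unary.Unique.Propositional.Properties as Unique using ()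
open import Data.Product using (_,_; proj₁; ∃-syntax)
open import Data.Sum using (inj₁; inj₂)
open import Relation.Nullary using (yes; no; contradiction)
open import Relation.Unary using (Pred; Decidable)
open import Relation.Binary.PropositionalEquality using (_≢_; refl; sym; trans; cong; subst)

private
  variable
    a b k u v x x′ : ℕ
    Y Z : List ℕ

prime∧3∣⇒≡3 : ∀ {p} → Prime p → 3 ∣ p → p ≡ 3
prime∧3∣⇒≡3 pp 3∣p with prime⇒irreducible pp 3∣p
... | inj₁ ()
... | inj₂ 3≡p = sym 3≡p

3∣∣r+q*3-r+t*3∣ : ∀ r q t → 3 ∣ ∣ r + q * 3 - r + t * 3 ∣
3∣∣r+q*3-r+t*3∣ r q t =
  divides ∣ q - t ∣ (trans (∣m+n-m+o∣≡∣n-o∣ r (q * 3) (t * 3)) (sym (*-distribʳ-∣-∣ 3 q t)))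

[1+q*3]+[2+t*3]≡[1+q+t]*3 : ∀ q t → (1 + q * 3) + (2 + t * 3) ≡ (1 + q + t) * 3
[1+q*3]+[2+t*3]≡[1+q+t]*3 = solve-∀

¬3∣⇒residue-1⊎2 : ∀ u → ¬ 3 ∣ u → ∃[ q ] (u ≡ 1 + q * 3 ⊎ u ≡ 2 + q * 3)
¬3∣⇒residue-1⊎2 u 3∤u with u % 3 | m≡m%n+[m/n]*n u 3 | m%n<n u 3
... | 0 | u≡ | _ = contradiction (divides (u / 3) u≡) 3∤u
... | 1 | u≡ | _ = u / 3 , inj₁ u≡
... | 2 | u≡ | _ = u / 3 , inj₂ u≡
... | suc (suc (suc _)) | _ | s≤s (s≤s (s≤s ()))

¬3∣⇒3∣+⊎3∣∣-∣ : ¬ 3 ∣ u → ¬ 3 ∣ v → 3 ∣ u + v ⊎ 3 ∣ ∣ u - v ∣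
¬3∣⇒3∣+⊎3∣∣-∣ {u} {v} 3∤u 3∤v with ¬3∣⇒residue-1⊎2 u 3∤u | ¬3∣⇒residue-1⊎2 v 3∤v
... | q , inj₁ refl | t , inj₁ refl = inj₂ (3∣∣r+q*3-r+t*3∣ 1 q t)
... | q , inj₂ refl | t , inj₂ refl = inj₂ (3∣∣r+q*3-r+t*3∣ 2 q t)
... | q , inj₁ refl | t , inj₂ refl = inj₁ (divides (1 + q + t) ([1+q*3]+[2+t*3]≡[1+q+t]*3 q t))
... | q , inj₂ refl | t , inj₁ refl =
  inj₁ (divides (1 + t + q) (trans (+-comm (2 + q * 3) (1 + t * 3)) ([1+q*3]+[2+t*3]≡[1+q+t]*3 t q)))

u+v≡3⇒∣u-v∣≡1 : u + v ≡ 3 → ¬ 3 ∣ u → ¬ 3 ∣ v → ∣ u - v ∣ ≡ 1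
u+v≡3⇒∣u-v∣≡1 {0} refl 3∤u 3∤v = contradiction (divides 0 refl) 3∤u
u+v≡3⇒∣u-v∣≡1 {1} refl 3∤u 3∤v = refl
u+v≡3⇒∣u-v∣≡1 {2} refl 3∤u 3∤v = refl
u+v≡3⇒∣u-v∣≡1 {3} refl 3∤u 3∤v = contradiction (divides 0 refl) 3∤v

3∣∧3∣∧prime[+]⇒+≡3 : 3 ∣ u → 3 ∣ v → Prime (u + v) → u + v ≡ 3
3∣∧3∣∧prime[+]⇒+≡3 3∣u 3∣v p = prime∧3∣⇒≡3 p (∣m∣n⇒∣m+n 3∣u 3∣v)

¬3∣∧¬3∣∧prime[+]∧prime[∣-∣]⇒∣-∣≡3 :
  ¬ 3 ∣ u → ¬ 3 ∣ v → Prime (u + v) → Prime ∣ u - v ∣ → ∣ u - v ∣ ≡ 3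
¬3∣∧¬3∣∧prime[+]∧prime[∣-∣]⇒∣-∣≡3 3∤u 3∤v p₊ p₋ with ¬3∣⇒3∣+⊎3∣∣-∣ 3∤u 3∤v
... | inj₁ 3∣u+v = contradiction (subst Prime (u+v≡3⇒∣u-v∣≡1 (prime∧3∣⇒≡3 p₊ 3∣u+v) 3∤u 3∤v) p₋) ¬prime[1]
... | inj₂ 3∣∣u-v∣ = prime∧3∣⇒≡3 p₋ 3∣∣u-v∣

adj-halves : ∀ u v → Adj (u * 2) (v * 2) → Prime (u + v) × Prime ∣ u - v ∣
adj-halves u v (_ , (p₊ , _) , (p₋ , _)) = subst Prime sum-halves p₊ , subst Prime diff-halves p₋
  where
  sum-halves : (u * 2 + v * 2) / 2 ≡ u + v
  sum-halves = trans (cong (_/ 2) (sym (*-distribʳ-+ 2 u v))) (m*n/n≡m (u + v) 2)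
  diff-halves : ∣ u * 2 - v * 2 ∣ / 2 ≡ ∣ u - v ∣
  diff-halves = trans (cong (_/ 2) (sym (*-distribʳ-∣-∣ 2 u v))) (m*n/n≡m ∣ u - v ∣ 2)

6∣2u⇒3∣u : ∀ u → 6 ∣ u * 2 → 3 ∣ u
6∣2u⇒3∣u u = *-cancelʳ-∣ 2

¬6∣2u⇒¬3∣u : ∀ u → ¬ 6 ∣ u * 2 → ¬ 3 ∣ u
¬6∣2u⇒¬3∣u u 6∤2u = 6∤2u ∘ *-monoˡ-∣ 2

6∣a∧6∣b∧adj⇒a+b≡6 : Even a → Even b → 6 ∣ a → 6 ∣ b → Adj a b → a + b ≡ 6
6∣a∧6∣b∧adj⇒a+b≡6 (divides u refl) (divides v refl) 6∣a 6∣b a~b =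
  trans (sym (*-distribʳ-+ 2 u v))
        (cong (_* 2) (3∣∧3∣∧prime[+]⇒+≡3 (6∣2u⇒3∣u u 6∣a) (6∣2u⇒3∣u v 6∣b) (proj₁ (adj-halves u v a~b))))

¬6∣a∧¬6∣b∧adj⇒∣a-b∣≡6 : Even a → Even b → ¬ 6 ∣ a → ¬ 6 ∣ b → Adj a b → ∣ a - b ∣ ≡ 6
¬6∣a∧¬6∣b∧adj⇒∣a-b∣≡6 (divides u refl) (divides v refl) 6∤a 6∤b a~b
  with p₊ , p₋ ← adj-halves u v a~b =
  trans (sym (*-distribʳ-∣-∣ 2 u v))
        (cong (_* 2) (¬3∣∧¬3∣∧prime[+]∧prime[∣-∣]⇒∣-∣≡3 (¬6∣2u⇒¬3∣u u 6∤a) (¬6∣2u⇒¬3∣u v 6∤b) p₊ p₋))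

∣m-n∣≡k⇒n+k≡m⊎m+k≡n : ∀ m n → ∣ m - n ∣ ≡ k → n + k ≡ m ⊎ m + k ≡ n
∣m-n∣≡k⇒n+k≡m⊎m+k≡n zero    n       refl = inj₂ refl
∣m-n∣≡k⇒n+k≡m⊎m+k≡n (suc m) zero    refl = inj₁ refl
∣m-n∣≡k⇒n+k≡m⊎m+k≡n (suc m) (suc n) eq with ∣m-n∣≡k⇒n+k≡m⊎m+k≡n m n eq
... | inj₁ n+k≡m = inj₁ (cong suc n+k≡m)
... | inj₂ m+k≡n = inj₂ (cong suc m+k≡n)

a+[a+k+k]≡2*[a+k] : ∀ a k → a + (a + k + k) ≡ 2 * (a + k)
a+[a+k+k]≡2*[a+k] = solve-∀

equidistant⇒a+b≡2*x : ∀ x a b → ∣ x - a ∣ ≡ k → ∣ x - b ∣ ≡ k → a ≢ b → a + b ≡ 2 * x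
equidistant⇒a+b≡2*x {k} x a b ∣x-a∣≡k ∣x-b∣≡k a≢b
  with ∣m-n∣≡k⇒n+k≡m⊎m+k≡n x a ∣x-a∣≡k | ∣m-n∣≡k⇒n+k≡m⊎m+k≡n x b ∣x-b∣≡k
... | inj₁ a+k≡x | inj₁ b+k≡x = contradiction (+-cancelʳ-≡ k a b (trans a+k≡x (sym b+k≡x))) a≢b
... | inj₂ x+k≡a | inj₂ x+k≡b = contradiction (trans (sym x+k≡a) x+k≡b) a≢b
... | inj₁ refl | inj₂ refl = a+[a+k+k]≡2*[a+k] a k
... | inj₂ refl | inj₁ refl = trans (+-comm (b + k + k) b) (a+[a+k+k]≡2*[a+k] b k)

module _ {a p} {A : Set a} {P : Pred A p} (P? : Decidable P) where

  length≡length-filter+length-filter-¬ :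
    ∀ xs → length xs ≡ length (filter P? xs) + length (filter (¬? ∘ P?) xs)
  length≡length-filter+length-filter-¬ []       = refl
  length≡length-filter+length-filter-¬ (x ∷ xs) with P? x
  ... | yes _ = cong suc (length≡length-filter+length-filter-¬ xs)
  ... | no  _ = trans (cong suc (length≡length-filter+length-filter-¬ xs))
                      (sym (+-suc _ (length (filter (¬? ∘ P?) xs))))

unique∧fixed-sum⇒length≤1 : ∀ {s} → Unique Z → All (λ z → x + z ≡ s) Z → length Z ≤ 1
unique∧fixed-sum⇒length≤1 {Z = []}    _ _ = z≤n
unique∧fixed-sum⇒length≤1 {Z = _ ∷ []} _ _ = s≤s z≤n
unique∧fixed-sum⇒length≤1 {Z = a ∷ b ∷ _} {x} ((a≢b ∷ _) ∷ _) (x+a≡s ∷ x+b≡s ∷ _) =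
  contradiction (+-cancelˡ-≡ x a b (trans x+a≡s (sym x+b≡s))) a≢b

unique∧equidistant⇒length≤2 : Unique Z → All (λ z → ∣ x - z ∣ ≡ k) Z → length Z ≤ 2
unique∧equidistant⇒length≤2 {Z = []}         _ _ = z≤n
unique∧equidistant⇒length≤2 {Z = _ ∷ []}     _ _ = s≤s z≤n
unique∧equidistant⇒length≤2 {Z = _ ∷ _ ∷ []} _ _ = s≤s (s≤s z≤n)
unique∧equidistant⇒length≤2 {Z = a ∷ b ∷ c ∷ _} {x}
  ((a≢b ∷ a≢c ∷ _) ∷ (b≢c ∷ _) ∷ _) (da ∷ db ∷ dc ∷ _) =
  contradiction (+-cancelˡ-≡ a b c (trans (equidistant⇒a+b≡2*x x a b da db a≢b)
                                         (sym (equidistant⇒a+b≡2*x x a c da dc a≢c)))) b≢c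

unique∧equidistant-from-two⇒length≤1 : x ≢ x′ → Unique Z →
  All (λ z → ∣ x - z ∣ ≡ k) Z → All (λ z → ∣ x′ - z ∣ ≡ k) Z → length Z ≤ 1
unique∧equidistant-from-two⇒length≤1 {Z = []}    _ _ _ _ = z≤n
unique∧equidistant-from-two⇒length≤1 {Z = _ ∷ []} _ _ _ _ = s≤s z≤n
unique∧equidistant-from-two⇒length≤1 {x} {x′} {Z = a ∷ b ∷ _}
  x≢x′ ((a≢b ∷ _) ∷ _) (da ∷ db ∷ _) (da′ ∷ db′ ∷ _) =
  contradiction (*-cancelˡ-≡ x x′ 2 (trans (sym (equidistant⇒a+b≡2*x x a b da db a≢b))
                                          (equidistant⇒a+b≡2*x x′ a b da′ db′ a≢b))) x≢x′

common-neighbour-of-6∣-pair⇒¬6∣ : ∀ {y} → Even x → Even x′ → Even y → 6 ∣ x → 6 ∣ x′ → x ≢ x′ →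
  Adj x y → Adj x′ y → ¬ 6 ∣ y
common-neighbour-of-6∣-pair⇒¬6∣ {x} {x′} {y} ex ex′ ey 6∣x 6∣x′ x≢x′ x~y x′~y 6∣y =
  x≢x′ (+-cancelʳ-≡ y x x′ (trans (6∣a∧6∣b∧adj⇒a+b≡6 ex ey 6∣x 6∣y x~y)
                                  (sym (6∣a∧6∣b∧adj⇒a+b≡6 ex′ ey 6∣x′ 6∣y x′~y))))

neighbours-6∣⇒fixed-sum : Even x → 6 ∣ x → All Even Y → All (Adj x) Y →
  All (λ z → x + z ≡ 6) (filter (6 ∣?_) Y)
neighbours-6∣⇒fixed-sum {Y = Y} ex 6∣x eY x~Y =
  All.zipWith (λ ((ez , x~z) , 6∣z) → 6∣a∧6∣b∧adj⇒a+b≡6 ex ez 6∣x 6∣z x~z)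
              (filter⁺ (6 ∣?_) (All.zip (eY , x~Y)) , all-filter (6 ∣?_) Y)

neighbours-¬6∣⇒equidistant : Even x → ¬ 6 ∣ x → All Even Y → All (Adj x) Y →
  All (λ z → ∣ x - z ∣ ≡ 6) (filter (¬? ∘ (6 ∣?_)) Y)
neighbours-¬6∣⇒equidistant {Y = Y} ex 6∤x eY x~Y =
  All.zipWith (λ ((ez , x~z) , 6∤z) → ¬6∣a∧¬6∣b∧adj⇒∣a-b∣≡6 ex ez 6∤x 6∤z x~z)
              (filter⁺ (¬? ∘ (6 ∣?_)) (All.zip (eY , x~Y)) , all-filter (¬? ∘ (6 ∣?_)) Y)

common-neighbours-of-6∣-and-¬6∣⇒length≤3 : Even x → Even x′ → 6 ∣ x → ¬ 6 ∣ x′ →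
  All Even Y → Unique Y → All (Adj x) Y → All (Adj x′) Y → length Y ≤ 3
common-neighbours-of-6∣-and-¬6∣⇒length≤3 {x′ = x′} {Y = Y} ex ex′ 6∣x 6∤x′ eY uY x~Y x′~Y = begin
  length Y                                                      ≡⟨ length≡length-filter+length-filter-¬ (6 ∣?_) Y ⟩
  length (filter (6 ∣?_) Y) + length (filter (¬? ∘ (6 ∣?_)) Y) ≤⟨ +-mono-≤ at-most-one at-most-two ⟩
  3                                                             ∎
  where
  open ≤-Reasoning
  at-most-one : length (filter (6 ∣?_) Y) ≤ 1
  at-most-one = unique∧fixed-sum⇒length≤1 (Unique.filter⁺ (6 ∣?_) uY) (neighbours-6∣⇒fixed-sum ex 6∣x eY x~Y)
  at-most-two : length (filter (¬? ∘ (6 ∣?_)) Y) ≤ 2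
  at-most-two = unique∧equidistant⇒length≤2 {x = x′} (Unique.filter⁺ (¬? ∘ (6 ∣?_)) uY)
                  (neighbours-¬6∣⇒equidistant ex′ 6∤x′ eY x′~Y)

mainTheorem14 : (x₁ x₂ : ℕ) (Y : List ℕ) →
    Even x₁ → Even x₂ → All Even Y →
    ¬ x₁ ≡ x₂ → Unique Y → x₁ ∉ Y → x₂ ∉ Y →
    3 < length Y →
    (∀ y → y ∈ Y → Adj x₁ y × Adj x₂ y) →
    ((6 ∣ x₁) × (6 ∣ x₂) × All (λ y → ¬ (6 ∣ y)) Y)
    ⊎ ((¬ (6 ∣ x₁)) × (¬ (6 ∣ x₂)) × length (filter (λ y → ¬? (6 ∣? y)) Y) ≤ 1)
mainTheorem14 x₁ x₂ Y ex₁ ex₂ eY x₁≢x₂ uY _ _ 3<|Y| adj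
  with 6 ∣? x₁ | 6 ∣? x₂ | All.unzip (All.tabulate (λ {y} → adj y))
... | yes 6∣x₁ | yes 6∣x₂ | x₁~Y , x₂~Y = inj₁ (6∣x₁ , 6∣x₂ , All.zipWith
        (λ (ey , x₁~y , x₂~y) → common-neighbour-of-6∣-pair⇒¬6∣ ex₁ ex₂ ey 6∣x₁ 6∣x₂ x₁≢x₂ x₁~y x₂~y)
        (eY , All.zip (x₁~Y , x₂~Y)))
... | yes 6∣x₁ | no 6∤x₂  | x₁~Y , x₂~Y = contradiction 3<|Y|
        (≤⇒≯ (common-neighbours-of-6∣-and-¬6∣⇒length≤3 ex₁ ex₂ 6∣x₁ 6∤x₂ eY uY x₁~Y x₂~Y))
... | no 6∤x₁  | yes 6∣x₂ | x₁~Y , x₂~Y = contradiction 3<|Y|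
        (≤⇒≯ (common-neighbours-of-6∣-and-¬6∣⇒length≤3 ex₂ ex₁ 6∣x₂ 6∤x₁ eY uY x₂~Y x₁~Y))
... | no 6∤x₁  | no 6∤x₂  | x₁~Y , x₂~Y = inj₂ (6∤x₁ , 6∤x₂ , unique∧equidistant-from-two⇒length≤1 x₁≢x₂
        (Unique.filter⁺ (¬? ∘ (6 ∣?_)) uY)
        (neighbours-¬6∣⇒equidistant ex₁ 6∤x₁ eY x₁~Y) (neighbours-¬6∣⇒equidistant ex₂ 6∤x₂ eY x₂~Y))
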